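{- For every finite simple graph $G$, $q(G;1)\ge e(G)+1$, with equality if and only if $G$ is the disjoint union of a complete tripartite graph (where one or two of the three vertex classes may be empty) and isolated vertices.
   Context: $e(G)$ is the number of edges of $G$. The interlace polynomial $q$ is the unique map from finite simple graphs to $\mathbb{Z}[x]$ with $q(E_n)=x^n$ for the edgeless graph $E_n$ on $n$ vertices and $q(G)=q(G-a)+q(G^{ab}-b)$ for every edge $ab$ of $G$; here the pivot $G^{ab}$ is obtained by partitioning the vertices other than $a,b$ into (1) adjacent to $a$ only, (2) adjacent to $b$ only, (3) adjacent to both, (4) adjacent to neither, and toggling the adjacency of every pair $\{x,y\}$ with $x,y$ in two different classes among (1),(2),(3). -}

module Defs where

open import Data.Bool using (Bool; true; false; _∧_; _∨_; not; _xor_; if_then_else_)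
open import Data.Nat using (ℕ; zero; suc; _+_)
open import Data.Integer as ℤ using (ℤ; +_)
open import Data.Fin using (Fin; zero; suc; punchIn; toℕ; _≟_)
open import Data.Fin.Properties using ()
open import Data.Nat using (_<ᵇ_)
open import Data.List using (List; []; _∷_; replicate; _++_)
open import Data.Product using (_×_; ∃)
open import Data.Sum using (_⊎_)
open import Relation.Nullary using (¬_)
open import Relation.Nullary.Decidable using (⌊_⌋)
open import Relation.Binary.PropositionalEquality using (_≡_; refl)

record Graph (n : ℕ) : Set where
  field
    adj    : Fin n → Fin n → Bool
    adj-sym : ∀ i j → adj i j ≡ adj j i
    irrefl : ∀ i → adj i i ≡ false
open Graph public

sumFin : ∀ n → (Fin n → ℕ) → ℕ
sumFin zero    f = 0
sumFin (suc n) f = f zero + sumFin n (λ i → f (suc i))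

bit : Bool → ℕ
bit true  = 1
bit false = 0

e : ∀ {n} → Graph n → ℕ
e {n} G = sumFin n (λ i → sumFin n (λ j → bit (adj G i j ∧ (toℕ i <ᵇ toℕ j))))

del : ∀ {n} → Fin (suc n) → Graph (suc n) → Graph n
del a G = record
  { adj    = λ i j → adj G (punchIn a i) (punchIn a j)
  ; adj-sym = λ i j → adj-sym G (punchIn a i) (punchIn a j)
  ; irrefl = λ i → irrefl G (punchIn a i)
  }

-- A vertex x ∉ {a,b} is in class (1),(2),(3) iff it is
-- adjacent to a or b; its class is determined by (adj a x , adj b x).
module _ {n : ℕ} (G : Graph n) (a b : Fin n) where
  private
    outside : Fin n → Bool
    outside x = not ⌊ x ≟ a ⌋ ∧ not ⌊ x ≟ b ⌋
    inClass : Fin n → Bool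
    inClass x = outside x ∧ (adj G a x ∨ adj G b x)
    sameClass : Fin n → Fin n → Bool
    sameClass x y = not (adj G a x xor adj G a y) ∧ not (adj G b x xor adj G b y)
    toggle : Fin n → Fin n → Bool
    toggle x y = inClass x ∧ inClass y ∧ not (sameClass x y)

    xor-comm : ∀ p q → (p xor q) ≡ (q xor p)
    xor-comm false false = refl
    xor-comm false true  = refl
    xor-comm true  false = refl
    xor-comm true  true  = refl

    ∧-comm : ∀ p q → (p ∧ q) ≡ (q ∧ p)
    ∧-comm false false = refl
    ∧-comm false true  = refl
    ∧-comm true  false = refl
    ∧-comm true  true  = refl

    xor-self : ∀ p → (p xor p) ≡ false
    xor-self false = refl
    xor-self true  = refl

    same-sym : ∀ x y → sameClass x y ≡ sameClass y x
    same-sym x y rewrite xor-comm (adj G a x) (adj G a y)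
                       | xor-comm (adj G b x) (adj G b y) = refl

    same-refl : ∀ x → sameClass x x ≡ true
    same-refl x rewrite xor-self (adj G a x) | xor-self (adj G b x) = refl

    swap3 : ∀ p q r → (p ∧ q ∧ r) ≡ (q ∧ p ∧ r)
    swap3 false false r = refl
    swap3 false true  r = refl
    swap3 true  false r = refl
    swap3 true  true  r = refl

    toggle-sym : ∀ x y → toggle x y ≡ toggle y x
    toggle-sym x y rewrite same-sym x y = swap3 (inClass x) (inClass y) _

    toggle-refl : ∀ x → toggle x x ≡ false
    toggle-refl x rewrite same-refl x with inClass x
    ... | false = refl
    ... | true  = refl

    pivAdj : Fin n → Fin n → Bool
    pivAdj x y = adj G x y xor toggle x y

    pivSym : ∀ x y → pivAdj x y ≡ pivAdj y x
    pivSym x y rewrite adj-sym G x y | toggle-sym x y = refl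

    pivIrr : ∀ x → pivAdj x x ≡ false
    pivIrr x rewrite irrefl G x | toggle-refl x = refl

  pivot : Graph n
  pivot = record { adj = pivAdj ; adj-sym = pivSym ; irrefl = pivIrr }

-- Polynomials in ℤ[x] as coefficient lists (constant term first),
-- compared up to trailing zeros.

Poly : Set
Poly = List ℤ

coeff : ℕ → Poly → ℤ
coeff k       []       = + 0
coeff zero    (c ∷ p)  = c
coeff (suc k) (c ∷ p)  = coeff k p

_≈ₚ_ : Poly → Poly → Set
p ≈ₚ r = ∀ k → coeff k p ≡ coeff k r

_+ₚ_ : Poly → Poly → Poly
[]      +ₚ r       = r
(c ∷ p) +ₚ []      = c ∷ p
(c ∷ p) +ₚ (d ∷ r) = (c ℤ.+ d) ∷ (p +ₚ r)

xpow : ℕ → Poly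
xpow n = replicate n (+ 0) ++ (+ 1 ∷ [])

eval1 : Poly → ℤ
eval1 []      = + 0
eval1 (c ∷ p) = c ℤ.+ eval1 p

Edgeless : ∀ {n} → Graph n → Set
Edgeless {n} G = ∀ (i j : Fin n) → adj G i j ≡ false

record IsInterlace (q : ∀ {n} → Graph n → Poly) : Set where
  field
    q-edgeless : ∀ {n} (G : Graph n) → Edgeless G → q G ≈ₚ xpow n
    q-edge     : ∀ {n} (G : Graph (suc n)) (a b : Fin (suc n)) →
                 adj G a b ≡ true →
                 q G ≈ₚ (q (del a G) +ₚ q (del b (pivot G a b)))

-- G is the disjoint union of a complete tripartite graph (classes possibly
-- empty) and isolated vertices: a labelling c with 0 = isolated vertex and
-- 1,2,3 = the three vertex classes, such that i ~ j iff both are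
-- non-isolated and lie in different classes.

TripartitePlusIsolated : ∀ {n} → Graph n → Set
TripartitePlusIsolated {n} G =
  ∃ λ (c : Fin n → Fin 4) → ∀ (i j : Fin n) →
    adj G i j ≡ (not ⌊ c i ≟ zero ⌋ ∧ not ⌊ c j ≟ zero ⌋ ∧ not ⌊ c i ≟ c j ⌋)

module Submission where

-- For an edge ab, e(G) = e(G - a) + deg a and e(G^ab - b) = deg a - 1 + e(G^ab - a - b),
-- so the recursion q(G) = q(G - a) + q(G^ab - b) makes the excess q(G;1) - e(G) - 1 the
-- sum of the excesses of G - a and G^ab - b and of e(G^ab - a - b).  By induction the
-- excess is a natural number, and it vanishes iff both smaller excesses vanish and
-- G^ab - a - b is edgeless.  The latter holds iff G is complete tripartite plus isolated
-- vertices: the pair (a ~ x , b ~ x) then records the part of x, so the pivot toggles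
-- exactly the edges away from a and b, and conversely these pairs give a tripartition.
-- Tripartiteness passes to G - a and to G^ab - b, which is then a star plus isolated vertices.

open import Defs
open import Data.Bool using (Bool; true; false; _∧_; _∨_; not; _xor_)
import Data.Bool as Bool
open import Data.Bool.Properties using (¬-not; xor-identityʳ; xor-same)
open import Data.Nat using (ℕ; zero; suc; _+_; _<ᵇ_)
open import Data.Nat.Properties
  using (+-assoc; +-0-commutativeMonoid; m+n≡0⇒m≡0; m+n≡0⇒n≡0; m≤m+n; +-identityʳ; +-cancelˡ-≡)
open import Data.Nat.Solver using (module +-*-Solver)
open import Data.Integer as ℤ using (+_; _≤_; +≤+)
import Data.Integer.Properties as ℤ
open import Data.Fin using (Fin; zero; suc; punchIn; punchOut; toℕ; _≟_)
open import Data.Fin.Patterns using (0F; 1F; 2F; 3F)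
open import Data.Fin.Properties
  using (toℕ-injective; punchInᵢ≢i; punchIn-injective; punchIn-punchOut; all?; any?)
open import Data.List using ([]; _∷_)
open import Data.Product using (_×_; _,_)
open import Function using (_∘_; _⇔_; mk⇔; Equivalence)
import Function.Properties.Equivalence as ⇔
open import Relation.Nullary using (¬_; Dec; yes; no; contradiction)
open import Relation.Nullary.Decidable using (⌊_⌋; isYes≗does; dec-true; dec-false; from-yes; _→-dec_)
open import Relation.Binary.PropositionalEquality
open import Algebra.Properties.CommutativeMonoid.Sum +-0-commutativeMonoid
  using (sum; sum-remove; ∑-distrib-+; sum-cong-≗; sum-replicate-zero)

open ≡-Reasoning

⌊⌋-true : ∀ {A : Set} (a? : Dec A) → A → ⌊ a? ⌋ ≡ true
⌊⌋-true a? a = trans (isYes≗does a?) (dec-true a? a)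

⌊⌋-false : ∀ {A : Set} (a? : Dec A) → ¬ A → ⌊ a? ⌋ ≡ false
⌊⌋-false a? ¬a = trans (isYes≗does a?) (dec-false a? ¬a)

data PunchView {n : ℕ} (v : Fin (suc n)) : Fin (suc n) → Set where
  here  : PunchView v v
  there : ∀ i → PunchView v (punchIn v i)

punchView : ∀ {n} (v i : Fin (suc n)) → PunchView v i
punchView v i with v ≟ i
... | yes refl = here
... | no v≢i   = subst (PunchView v) (punchIn-punchOut v≢i) (there (punchOut v≢i))

sumFin≡sum : ∀ n (f : Fin n → ℕ) → sumFin n f ≡ sum f
sumFin≡sum zero    f = refl
sumFin≡sum (suc n) f = cong (_+_ (f zero)) (sumFin≡sum n (f ∘ suc))

sum≡0⇒≡0 : ∀ {n} (f : Fin (suc n) → ℕ) → sum f ≡ 0 → ∀ i → f i ≡ 0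
sum≡0⇒≡0 f ∑f≡0 i = m+n≡0⇒m≡0 (f i) (trans (sym (sum-remove {i = i} f)) ∑f≡0)

edgeBit : ∀ {n} → Graph n → Fin n → Fin n → ℕ
edgeBit G i j = bit (adj G i j ∧ (toℕ i <ᵇ toℕ j))

degree : ∀ {n} → Graph n → Fin n → ℕ
degree G v = sum λ j → bit (adj G v j)

e≡∑∑edgeBit : ∀ {n} (G : Graph n) → e G ≡ sum λ i → sum λ j → edgeBit G i j
e≡∑∑edgeBit {n} G =
  trans (sumFin≡sum n _) (sum-cong-≗ λ i → sumFin≡sum n (edgeBit G i))

<ᵇ-trichotomy : ∀ m n → m ≢ n → bit (m <ᵇ n) + bit (n <ᵇ m) ≡ 1
<ᵇ-trichotomy zero    zero    m≢n = contradiction refl m≢n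
<ᵇ-trichotomy zero    (suc n) _   = refl
<ᵇ-trichotomy (suc m) zero    _   = refl
<ᵇ-trichotomy (suc m) (suc n) m≢n = <ᵇ-trichotomy m n (m≢n ∘ cong suc)

edgeBit-pair : ∀ {n} (G : Graph n) i j → edgeBit G i j + edgeBit G j i ≡ bit (adj G i j)
edgeBit-pair G i j rewrite adj-sym G j i with adj G i j in ij
... | false = refl
... | true  = <ᵇ-trichotomy (toℕ i) (toℕ j) i≢j
  where
  i≢j : toℕ i ≢ toℕ j
  i≢j eq with toℕ-injective eq
  ... | refl = contradiction (trans (sym ij) (irrefl G i)) λ ()

punchIn-<ᵇ : ∀ {n} (v : Fin (suc n)) (i j : Fin n) →
             (toℕ (punchIn v i) <ᵇ toℕ (punchIn v j)) ≡ (toℕ i <ᵇ toℕ j)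
punchIn-<ᵇ zero    i       j       = refl
punchIn-<ᵇ (suc v) zero    zero    = refl
punchIn-<ᵇ (suc v) zero    (suc j) = refl
punchIn-<ᵇ (suc v) (suc i) zero    = refl
punchIn-<ᵇ (suc v) (suc i) (suc j) = punchIn-<ᵇ v i j

e-del : ∀ {n} (G : Graph (suc n)) (v : Fin (suc n)) → e G ≡ degree G v + e (del v G)
e-del {n} G v = begin
  e G
    ≡⟨ e≡∑∑edgeBit G ⟩
  sum (λ i → sum (F i))
    ≡⟨ sum-remove {i = v} (λ i → sum (F i)) ⟩
  sum (F v) + sum (λ i → sum (F (v⁺ i)))
    ≡⟨ cong (_+_ (sum (F v))) (sum-cong-≗ λ i → sum-remove {i = v} (F (v⁺ i))) ⟩
  sum (F v) + sum (λ i → F (v⁺ i) v + sum (λ j → F (v⁺ i) (v⁺ j)))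
    ≡⟨ cong (_+_ (sum (F v))) (∑-distrib-+ (λ i → F (v⁺ i) v) (λ i → sum (λ j → F (v⁺ i) (v⁺ j)))) ⟩
  sum (F v) + (sum (λ i → F (v⁺ i) v) + sum (λ i → sum (λ j → F (v⁺ i) (v⁺ j))))
    ≡⟨ +-assoc (sum (F v)) _ _ ⟨
  (sum (F v) + sum (λ i → F (v⁺ i) v)) + sum (λ i → sum (λ j → F (v⁺ i) (v⁺ j)))
    ≡⟨ cong₂ _+_ incident (sym (e-del-remainder)) ⟩
  degree G v + e (del v G)
    ∎
  where
  F : Fin (suc n) → Fin (suc n) → ℕ
  F = edgeBit G

  v⁺ : Fin n → Fin (suc n)
  v⁺ = punchIn v

  incident : sum (F v) + sum (λ i → F (v⁺ i) v) ≡ degree G v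
  incident = begin
    sum (F v) + sum (λ i → F (v⁺ i) v)
      ≡⟨ cong (_+_ (sum (F v))) without-loop ⟨
    sum (F v) + sum (λ i → F i v)
      ≡⟨ ∑-distrib-+ (F v) (λ i → F i v) ⟨
    sum (λ j → F v j + F j v)
      ≡⟨ sum-cong-≗ (edgeBit-pair G v) ⟩
    degree G v
      ∎
    where
    loop : F v v ≡ 0
    loop rewrite irrefl G v = refl

    without-loop : sum (λ i → F i v) ≡ sum (λ i → F (v⁺ i) v)
    without-loop = trans (sum-remove {i = v} (λ i → F i v)) (cong (_+ sum (λ i → F (v⁺ i) v)) loop)

  e-del-remainder : e (del v G) ≡ sum (λ i → sum (λ j → F (v⁺ i) (v⁺ j)))
  e-del-remainder = trans (e≡∑∑edgeBit (del v G)) (sum-cong-≗ λ i → sum-cong-≗ λ j →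
    cong (λ t → bit (adj G (v⁺ i) (v⁺ j) ∧ t)) (sym (punchIn-<ᵇ v i j)))

edgeless⇒e≡0 : ∀ {n} (G : Graph n) → Edgeless G → e G ≡ 0
edgeless⇒e≡0 {n} G edgeless = begin
  e G                                       ≡⟨ e≡∑∑edgeBit G ⟩
  sum (λ i → sum (λ j → edgeBit G i j))   ≡⟨ sum-cong-≗ (λ i → sum-cong-≗ (no-edge i)) ⟩
  sum {n} (λ _ → sum {n} (λ _ → 0))       ≡⟨ sum-cong-≗ {n} (λ _ → sum-replicate-zero n) ⟩
  sum {n} (λ _ → 0)                       ≡⟨ sum-replicate-zero n ⟩
  0                                         ∎
  where
  no-edge : ∀ i j → edgeBit G i j ≡ 0
  no-edge i j rewrite edgeless i j = refl

e≡0⇒edgeless : ∀ {n} (G : Graph n) → e G ≡ 0 → Edgeless G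
e≡0⇒edgeless {suc n} G e≡0 i j = bit≡0 (begin
  bit (adj G i j)                    ≡⟨ edgeBit-pair G i j ⟨
  edgeBit G i j + edgeBit G j i     ≡⟨ cong₂ _+_ (no-edge i j) (no-edge j i) ⟩
  0                                  ∎)
  where
  bit≡0 : ∀ {x} → bit x ≡ 0 → x ≡ false
  bit≡0 {false} _ = refl

  no-edge : ∀ i j → edgeBit G i j ≡ 0
  no-edge i = sum≡0⇒≡0 (edgeBit G i) (sum≡0⇒≡0 (λ i → sum (edgeBit G i)) (trans (sym (e≡∑∑edgeBit G)) e≡0) i)

tripartiteAdj : Fin 4 → Fin 4 → Bool
tripartiteAdj c d = not ⌊ c ≟ 0F ⌋ ∧ not ⌊ d ≟ 0F ⌋ ∧ not ⌊ c ≟ d ⌋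

tripartiteAdj-comm : ∀ c d → tripartiteAdj c d ≡ tripartiteAdj d c
tripartiteAdj-comm = from-yes (all? λ c → all? λ d → tripartiteAdj c d Bool.≟ tripartiteAdj d c)

Labels : ∀ {n} → Graph n → (Fin n → Fin 4) → Fin n → Fin n → Set
Labels G c i j = adj G i j ≡ tripartiteAdj (c i) (c j)

Labels-flip : ∀ {n} (G : Graph n) c i j → Labels G c j i → Labels G c i j
Labels-flip G c i j ji = trans (adj-sym G i j) (trans ji (tripartiteAdj-comm (c j) (c i)))

edgeless⇒tripartite : ∀ {n} (G : Graph n) → Edgeless G → TripartitePlusIsolated G
edgeless⇒tripartite G edgeless = (λ _ → 0F) , edgeless

tripartite-del : ∀ {n} (G : Graph (suc n)) v → TripartitePlusIsolated G → TripartitePlusIsolated (del v G)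
tripartite-del G v (c , labels) = c ∘ punchIn v , λ i j → labels (punchIn v i) (punchIn v j)

-- The label of x read off from (adj a x , adj b x) for an edge ab; a gets 2F and b gets 1F.
classOf : Bool → Bool → Fin 4
classOf false false = 0F
classOf true  false = 1F
classOf false true  = 2F
classOf true  true  = 3F

classOf-adjˡ : ∀ α β → α ≡ tripartiteAdj 2F (classOf α β)
classOf-adjˡ false false = refl
classOf-adjˡ true  false = refl
classOf-adjˡ false true  = refl
classOf-adjˡ true  true  = refl

classOf-adjʳ : ∀ α β → β ≡ tripartiteAdj 1F (classOf α β)
classOf-adjʳ false false = refl
classOf-adjʳ true  false = refl
classOf-adjʳ false true  = refl
classOf-adjʳ true  true  = refl

classOf-falseʳ : ∀ α α′ → tripartiteAdj (classOf α false) (classOf α′ false) ≡ false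
classOf-falseʳ false _     = refl
classOf-falseʳ true  false = refl
classOf-falseʳ true  true  = refl

star⇒tripartite : ∀ {n} (K : Graph (suc n)) v → Edgeless (del v K) → TripartitePlusIsolated K
star⇒tripartite K v edgeless = label , labels
  where
  label : Fin _ → Fin 4
  label i = classOf (adj K v i) ⌊ v ≟ i ⌋

  centre : ∀ j → Labels K label v j
  centre j rewrite irrefl K v | ⌊⌋-true (v ≟ v) refl = classOf-adjˡ (adj K v j) ⌊ v ≟ j ⌋

  leaves : ∀ i j → Labels K label (punchIn v i) (punchIn v j)
  leaves i j
    rewrite ⌊⌋-false (v ≟ punchIn v i) (punchInᵢ≢i v i ∘ sym)
          | ⌊⌋-false (v ≟ punchIn v j) (punchInᵢ≢i v j ∘ sym)
    = trans (edgeless i j) (sym (classOf-falseʳ (adj K v (punchIn v i)) (adj K v (punchIn v j))))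

  labels : ∀ i j → Labels K label i j
  labels i j with punchView v i | punchView v j
  ... | here     | _        = centre j
  ... | there i′ | here     = Labels-flip K label _ v (centre (punchIn v i′))
  ... | there i′ | there j′ = leaves i′ j′

classToggle : Bool → Bool → Bool → Bool → Bool
classToggle α β α′ β′ = (α ∨ β) ∧ (α′ ∨ β′) ∧ not (not (α xor α′) ∧ not (β xor β′))

classToggle-classOf : ∀ α β α′ β′ → classToggle α β α′ β′ ≡ tripartiteAdj (classOf α β) (classOf α′ β′)
classToggle-classOf false false _     _     = refl
classToggle-classOf true  false false false = refl
classToggle-classOf true  false true  false = refl
classToggle-classOf true  false false true  = refl
classToggle-classOf true  false true  true  = refl
classToggle-classOf false true  false false = refl
classToggle-classOf false true  true  false = refl
classToggle-classOf false true  false true  = refl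
classToggle-classOf false true  true  true  = refl
classToggle-classOf true  true  false false = refl
classToggle-classOf true  true  true  false = refl
classToggle-classOf true  true  false true  = refl
classToggle-classOf true  true  true  true  = refl

classToggle-tripartiteAdj : ∀ ca cb cx cy → tripartiteAdj ca cb ≡ true →
  tripartiteAdj cx cy ≡ classToggle (tripartiteAdj ca cx) (tripartiteAdj cb cx)
                                    (tripartiteAdj ca cy) (tripartiteAdj cb cy)
classToggle-tripartiteAdj = from-yes (all? λ ca → all? λ cb → all? λ cx → all? λ cy →
  (tripartiteAdj ca cb Bool.≟ true) →-dec
  (tripartiteAdj cx cy Bool.≟ classToggle (tripartiteAdj ca cx) (tripartiteAdj cb cx)
                                          (tripartiteAdj ca cy) (tripartiteAdj cb cy)))

module _ {n} (G : Graph n) (a b : Fin n) where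

  pivot-adj : ∀ x y → x ≢ a → x ≢ b → y ≢ a → y ≢ b →
    adj (pivot G a b) x y ≡ adj G x y xor classToggle (adj G a x) (adj G b x) (adj G a y) (adj G b y)
  pivot-adj x y x≢a x≢b y≢a y≢b
    rewrite ⌊⌋-false (x ≟ a) x≢a | ⌊⌋-false (x ≟ b) x≢b
          | ⌊⌋-false (y ≟ a) y≢a | ⌊⌋-false (y ≟ b) y≢b = refl

  pivot-adjˡ : ∀ x → adj (pivot G a b) a x ≡ adj G a x
  pivot-adjˡ x rewrite ⌊⌋-true (a ≟ a) refl = xor-identityʳ (adj G a x)

xor≡false⇒≡ : ∀ x y → x xor y ≡ false → x ≡ y
xor≡false⇒≡ false false _ = refl
xor≡false⇒≡ true  true  _ = refl

-- The edge ab is given by b and the position a′ of a in G - b, which builds in a ≢ b.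
module PivotStep {n} (G : Graph (2 + n)) (b : Fin (2 + n)) (a′ : Fin (1 + n)) where

  a : Fin (2 + n)
  a = punchIn b a′

  G∖a : Graph (1 + n)
  G∖a = del a G

  Gᵃᵇ∖b : Graph (1 + n)
  Gᵃᵇ∖b = del b (pivot G a b)

  Gᵃᵇ∖ab : Graph n
  Gᵃᵇ∖ab = del a′ Gᵃᵇ∖b

  outside : Fin n → Fin (2 + n)
  outside x = punchIn b (punchIn a′ x)

  outside≢a : ∀ x → outside x ≢ a
  outside≢a x = punchInᵢ≢i a′ x ∘ punchIn-injective b _ _

  outside≢b : ∀ x → outside x ≢ b
  outside≢b x = punchInᵢ≢i b _

  data PivotView : Fin (2 + n) → Set where
    at-a       : PivotView a
    at-b       : PivotView b
    outside-ab : ∀ x → PivotView (outside x)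

  pivotView : ∀ i → PivotView i
  pivotView i with punchView b i
  ... | here     = at-b
  ... | there i′ with punchView a′ i′
  ...   | here   = at-a
  ...   | there x = outside-ab x

  pivot-outside : ∀ x y → adj Gᵃᵇ∖ab x y ≡
    adj G (outside x) (outside y) xor
      classToggle (adj G a (outside x)) (adj G b (outside x)) (adj G a (outside y)) (adj G b (outside y))
  pivot-outside x y = pivot-adj G a b (outside x) (outside y)
    (outside≢a x) (outside≢b x) (outside≢a y) (outside≢b y)

  module _ (ab : adj G a b ≡ true) where

    degree-pivot : degree G a ≡ 1 + degree Gᵃᵇ∖b a′
    degree-pivot = begin
      degree G a
        ≡⟨ sum-cong-≗ (λ x → cong bit (pivot-adjˡ G a b x)) ⟨
      degree (pivot G a b) a
        ≡⟨ sum-remove {i = b} (λ x → bit (adj (pivot G a b) a x)) ⟩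
      bit (adj (pivot G a b) a b) + degree Gᵃᵇ∖b a′
        ≡⟨ cong (λ t → bit t + degree Gᵃᵇ∖b a′) (trans (pivot-adjˡ G a b b) ab) ⟩
      1 + degree Gᵃᵇ∖b a′
        ∎

    e-pivotStep : e G∖a + (1 + e Gᵃᵇ∖b) ≡ e G + e Gᵃᵇ∖ab
    e-pivotStep = begin
      e G∖a + (1 + e Gᵃᵇ∖b)
        ≡⟨ cong (λ t → e G∖a + (1 + t)) (e-del Gᵃᵇ∖b a′) ⟩
      e G∖a + (1 + (degree Gᵃᵇ∖b a′ + e Gᵃᵇ∖ab))
        ≡⟨ shuffle (e G∖a) (degree Gᵃᵇ∖b a′) (e Gᵃᵇ∖ab) ⟩
      (1 + degree Gᵃᵇ∖b a′) + e G∖a + e Gᵃᵇ∖ab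
        ≡⟨ cong (λ t → t + e G∖a + e Gᵃᵇ∖ab) degree-pivot ⟨
      degree G a + e G∖a + e Gᵃᵇ∖ab
        ≡⟨ cong (_+ e Gᵃᵇ∖ab) (e-del G a) ⟨
      e G + e Gᵃᵇ∖ab
        ∎
      where
      shuffle : ∀ x d y → x + (1 + (d + y)) ≡ (1 + d) + x + y
      shuffle = solve 3 (λ x d y → x :+ (con 1 :+ (d :+ y)) := (con 1 :+ d) :+ x :+ y) refl
        where open +-*-Solver

    tripartite⇒Gᵃᵇ∖ab-edgeless : TripartitePlusIsolated G → Edgeless Gᵃᵇ∖ab
    tripartite⇒Gᵃᵇ∖ab-edgeless (c , labels) x y = trans (pivot-outside x y) toggled
      where
      X Y : Fin (2 + n)
      X = outside x
      Y = outside y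

      toggled : adj G X Y xor classToggle (adj G a X) (adj G b X) (adj G a Y) (adj G b Y) ≡ false
      toggled rewrite labels X Y | labels a X | labels b X | labels a Y | labels b Y =
        trans (cong (_xor toggle) (classToggle-tripartiteAdj (c a) (c b) (c X) (c Y) (trans (sym (labels a b)) ab)))
              (xor-same toggle)
        where
        toggle : Bool
        toggle = classToggle (tripartiteAdj (c a) (c X)) (tripartiteAdj (c b) (c X))
                             (tripartiteAdj (c a) (c Y)) (tripartiteAdj (c b) (c Y))

    Gᵃᵇ∖ab-edgeless⇒tripartite : Edgeless Gᵃᵇ∖ab → TripartitePlusIsolated G
    Gᵃᵇ∖ab-edgeless⇒tripartite edgeless = label , labels
      where
      label : Fin (2 + n) → Fin 4
      label i = classOf (adj G a i) (adj G b i)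

      row-a : ∀ j → Labels G label a j
      row-a j rewrite irrefl G a | adj-sym G b a | ab = classOf-adjˡ (adj G a j) (adj G b j)

      row-b : ∀ j → Labels G label b j
      row-b j rewrite ab | irrefl G b = classOf-adjʳ (adj G a j) (adj G b j)

      rows-outside : ∀ x y → Labels G label (outside x) (outside y)
      rows-outside x y = trans
        (xor≡false⇒≡ _ _ (trans (sym (pivot-outside x y)) (edgeless x y)))
        (classToggle-classOf (adj G a (outside x)) (adj G b (outside x)) (adj G a (outside y)) (adj G b (outside y)))

      labels : ∀ i j → Labels G label i j
      labels i j with pivotView i | pivotView j
      ... | at-a         | _             = row-a j
      ... | at-b         | _             = row-b j
      ... | outside-ab x | at-a          = Labels-flip G label _ a (row-a _)
      ... | outside-ab x | at-b          = Labels-flip G label _ b (row-b _)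
      ... | outside-ab x | outside-ab y  = rows-outside x y

data EdgeView {n} (G : Graph (2 + n)) : Set where
  no-edge : Edgeless G → EdgeView G
  edge     : ∀ b a′ → adj G (punchIn b a′) b ≡ true → EdgeView G

edgeView : ∀ {n} (G : Graph (2 + n)) → EdgeView G
edgeView G with any? (λ b → any? λ a′ → adj G (punchIn b a′) b Bool.≟ true)
... | yes (b , a′ , ab) = edge b a′ ab
... | no ¬edge          = no-edge edgeless
  where
  edgeless : Edgeless G
  edgeless i j with punchView j i
  ... | here     = irrefl G j
  ... | there i′ = ¬-not λ ij → ¬edge (j , i′ , ij)

module _ (P : ∀ {n} → Graph n → Set)
         (base : ∀ {n} (G : Graph n) → Edgeless G → P G)
         (step : ∀ {n} (G : Graph (2 + n)) b a′ → adj G (punchIn b a′) b ≡ true →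
                 P (PivotStep.G∖a G b a′) → P (PivotStep.Gᵃᵇ∖b G b a′) → P G)
  where

  -- Passing the induction hypothesis to a helper, rather than recursing under a `with`
  -- on edgeView G, lets the termination checker see that the graphs shrink.
  private
    byEdgeView : ∀ {n} (G : Graph (2 + n)) → (∀ (H : Graph (1 + n)) → P H) → EdgeView G → P G
    byEdgeView G ih (no-edge E)   = base G E
    byEdgeView G ih (edge b a′ ab) = step G b a′ ab (ih _) (ih _)

  pivotInduction : ∀ {n} (G : Graph n) → P G
  pivotInduction {zero}        G = base G λ ()
  pivotInduction {suc zero}    G = base G λ { zero zero → irrefl G zero }
  pivotInduction {suc (suc n)} G = byEdgeView G (pivotInduction {suc n}) (edgeView G)

eval1-zero : ∀ p → (∀ k → coeff k p ≡ + 0) → eval1 p ≡ + 0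
eval1-zero []      _     = refl
eval1-zero (c ∷ p) p≈0 rewrite p≈0 0 = trans (ℤ.+-identityˡ _) (eval1-zero p (p≈0 ∘ suc))

eval1-cong : ∀ p r → p ≈ₚ r → eval1 p ≡ eval1 r
eval1-cong []      r       p≈r = sym (eval1-zero r (sym ∘ p≈r))
eval1-cong (c ∷ p) []      p≈r = eval1-zero (c ∷ p) p≈r
eval1-cong (c ∷ p) (d ∷ r) p≈r = cong₂ ℤ._+_ (p≈r 0) (eval1-cong p r (p≈r ∘ suc))

eval1-+ₚ : ∀ p r → eval1 (p +ₚ r) ≡ eval1 p ℤ.+ eval1 r
eval1-+ₚ []      r       = sym (ℤ.+-identityˡ _)
eval1-+ₚ (c ∷ p) []      = sym (ℤ.+-identityʳ _)
eval1-+ₚ (c ∷ p) (d ∷ r) = begin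
  (c ℤ.+ d) ℤ.+ eval1 (p +ₚ r)            ≡⟨ cong (ℤ._+_ (c ℤ.+ d)) (eval1-+ₚ p r) ⟩
  (c ℤ.+ d) ℤ.+ (eval1 p ℤ.+ eval1 r)     ≡⟨ interchange c d (eval1 p) (eval1 r) ⟩
  (c ℤ.+ eval1 p) ℤ.+ (d ℤ.+ eval1 r)     ∎
  where open import Algebra.Properties.CommutativeSemigroup ℤ.+-commutativeSemigroup using (interchange)

eval1-xpow : ∀ n → eval1 (xpow n) ≡ + 1
eval1-xpow zero    = refl
eval1-xpow (suc n) = trans (ℤ.+-identityˡ _) (eval1-xpow n)

module _ (q : ∀ {n} → Graph n → Poly) (isInterlace : IsInterlace q) where
  open IsInterlace isInterlace

  record Excess {n} (G : Graph n) : Set where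
    field
      excess              : ℕ
      q-at-1              : eval1 (q G) ≡ + (e G + 1 + excess)
      excess≡0⇔tripartite : excess ≡ 0 ⇔ TripartitePlusIsolated G

  excess-edgeless : ∀ {n} (G : Graph n) → Edgeless G → Excess G
  excess-edgeless {n} G edgeless = record
    { excess              = 0
    ; q-at-1              = q-at-1
    ; excess≡0⇔tripartite = mk⇔ (λ _ → edgeless⇒tripartite G edgeless) (λ _ → refl)
    }
    where
    q-at-1 : eval1 (q G) ≡ + (e G + 1 + 0)
    q-at-1 rewrite edgeless⇒e≡0 G edgeless = trans (eval1-cong (q G) (xpow n) (q-edgeless G edgeless)) (eval1-xpow n)

  excess-step : ∀ {n} (G : Graph (2 + n)) b a′ → adj G (punchIn b a′) b ≡ true →
                Excess (PivotStep.G∖a G b a′) → Excess (PivotStep.Gᵃᵇ∖b G b a′) → Excess G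
  excess-step G b a′ ab ih₁ ih₂ = record
    { excess              = k₁ + k₂ + e Gᵃᵇ∖ab
    ; q-at-1              = q-at-1
    ; excess≡0⇔tripartite = mk⇔ to from
    }
    where
    open PivotStep G b a′
    open Excess ih₁ renaming (excess to k₁; q-at-1 to q₁; excess≡0⇔tripartite to k₁≡0⇔)
    open Excess ih₂ renaming (excess to k₂; q-at-1 to q₂; excess≡0⇔tripartite to k₂≡0⇔)

    edge-count : (e G∖a + 1 + k₁) + (e Gᵃᵇ∖b + 1 + k₂) ≡ e G + 1 + (k₁ + k₂ + e Gᵃᵇ∖ab)
    edge-count = begin
      (e G∖a + 1 + k₁) + (e Gᵃᵇ∖b + 1 + k₂)    ≡⟨ shuffle₁ (e G∖a) (e Gᵃᵇ∖b) k₁ k₂ ⟩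
      e G∖a + (1 + e Gᵃᵇ∖b) + 1 + (k₁ + k₂)    ≡⟨ cong (λ t → t + 1 + (k₁ + k₂)) (e-pivotStep ab) ⟩
      e G + e Gᵃᵇ∖ab + 1 + (k₁ + k₂)            ≡⟨ shuffle₂ (e G) (e Gᵃᵇ∖ab) k₁ k₂ ⟩
      e G + 1 + (k₁ + k₂ + e Gᵃᵇ∖ab)           ∎
      where
      open +-*-Solver
      shuffle₁ : ∀ x y k l → (x + 1 + k) + (y + 1 + l) ≡ x + (1 + y) + 1 + (k + l)
      shuffle₁ = solve 4 (λ x y k l →
        (x :+ con 1 :+ k) :+ (y :+ con 1 :+ l) := x :+ (con 1 :+ y) :+ con 1 :+ (k :+ l)) refl
      shuffle₂ : ∀ x y k l → x + y + 1 + (k + l) ≡ x + 1 + (k + l + y)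
      shuffle₂ = solve 4 (λ x y k l → x :+ y :+ con 1 :+ (k :+ l) := x :+ con 1 :+ (k :+ l :+ y)) refl

    q-at-1 : eval1 (q G) ≡ + (e G + 1 + (k₁ + k₂ + e Gᵃᵇ∖ab))
    q-at-1 = begin
      eval1 (q G)                                       ≡⟨ eval1-cong (q G) (q G∖a +ₚ q Gᵃᵇ∖b) (q-edge G a b ab) ⟩
      eval1 (q G∖a +ₚ q Gᵃᵇ∖b)                         ≡⟨ eval1-+ₚ (q G∖a) (q Gᵃᵇ∖b) ⟩
      eval1 (q G∖a) ℤ.+ eval1 (q Gᵃᵇ∖b)               ≡⟨ cong₂ ℤ._+_ q₁ q₂ ⟩
      + (e G∖a + 1 + k₁) ℤ.+ + (e Gᵃᵇ∖b + 1 + k₂)     ≡⟨ ℤ.pos-+ (e G∖a + 1 + k₁) (e Gᵃᵇ∖b + 1 + k₂) ⟨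
      + ((e G∖a + 1 + k₁) + (e Gᵃᵇ∖b + 1 + k₂))       ≡⟨ cong +_ edge-count ⟩
      + (e G + 1 + (k₁ + k₂ + e Gᵃᵇ∖ab))               ∎

    to : k₁ + k₂ + e Gᵃᵇ∖ab ≡ 0 → TripartitePlusIsolated G
    to K≡0 = Gᵃᵇ∖ab-edgeless⇒tripartite ab (e≡0⇒edgeless Gᵃᵇ∖ab (m+n≡0⇒n≡0 (k₁ + k₂) K≡0))

    from : TripartitePlusIsolated G → k₁ + k₂ + e Gᵃᵇ∖ab ≡ 0
    from tripartite = cong₂ _+_
      (cong₂ _+_ (Equivalence.from k₁≡0⇔ (tripartite-del G a tripartite))
                 (Equivalence.from k₂≡0⇔ (star⇒tripartite Gᵃᵇ∖b a′ edgeless)))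
      (edgeless⇒e≡0 Gᵃᵇ∖ab edgeless)
      where
      edgeless : Edgeless Gᵃᵇ∖ab
      edgeless = tripartite⇒Gᵃᵇ∖ab-edgeless ab tripartite

  excessOf : ∀ {n} (G : Graph n) → Excess G
  excessOf = pivotInduction Excess excess-edgeless excess-step

proposition48 : (q : ∀ {n} → Graph n → Poly) → IsInterlace q →
                ∀ (n : ℕ) (G : Graph n) →
                  (+ (e G + 1) ≤ eval1 (q G))
                  × ((eval1 (q G) ≡ + (e G + 1)) ⇔ TripartitePlusIsolated G)
proposition48 q isInterlace n G = lower-bound , ⇔.trans tight excess≡0⇔tripartite
  where
  open Excess (excessOf q isInterlace G)

  lower-bound : + (e G + 1) ≤ eval1 (q G)
  lower-bound = subst (+ (e G + 1) ≤_) (sym q-at-1) (+≤+ (m≤m+n (e G + 1) excess))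

  tight : (eval1 (q G) ≡ + (e G + 1)) ⇔ excess ≡ 0
  tight = mk⇔
    (λ q≡ → +-cancelˡ-≡ (e G + 1) excess 0
              (trans (ℤ.+-injective (trans (sym q-at-1) q≡)) (sym (+-identityʳ (e G + 1)))))
    (λ excess≡0 → trans q-at-1 (cong +_ (trans (cong (_+_ (e G + 1)) excess≡0) (+-identityʳ (e G + 1)))))
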